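{- Let $m\ge 2$ and $n\ge 0$ be integers. For an $m$-regular linear stack $S$ on $[n+m-1]$, let $\theta_m(S)$ be the diagram on $[n]$ whose arcs are the pairs $(i,j-m+1)$ for the arcs $(i,j)$ of $S$ (i.e. every arc $(i,j)$ is replaced by $(i,j-m+1)$ and the vertices $n+1,\dots,n+m-1$ are then deleted). Then $\theta_m$ is a well-defined bijection from the set of $m$-regular linear stacks on $[n+m-1]$ onto the set of $m$-reduced zigzag stacks on $[n]$.
   Context: $[n]=\{1,\dots,n\}$. A diagram on $[n]$ is a simple graph on vertex set $[n]$, vertices drawn in increasing order on a line; an edge $\{i,j\}$ with $i<j$ is an arc $(i,j)$ of length $j-i$. Arcs $(i_1,j_1),(i_2,j_2)$ cross if $i_1<i_2<j_1<j_2$; a stack is a diagram without crossing arcs. A stack is $m$-regular if all arcs have length at least $m$, and linear if all vertex degrees are at most $2$. For a vertex $v$, $\mathrm{ld}(v)$ (resp. $\mathrm{rd}(v)$) is the number of arcs $(i,v)$ with $i<v$ (resp. $(v,j)$ with $j>v$). A zigzag stack is a stack in which every vertex has degree at most $2$ and no vertex $v$ has both $\mathrm{ld}(v)>0$ and $\mathrm{rd}(v)>0$. A zigzag stack on $[n]$ is $m$-reduced if (1) $\mathrm{ld}(i)+\mathrm{rd}(i+m-1)\le 2$ for all $1\le i\le n-m+1$, and (2) whenever $1\le i<j\le n$, $\mathrm{ld}(i)>0$ and $\mathrm{rd}(j)>0$, we have $j-i\ge m-1$. -}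

module Defs where

open import Data.Nat using (ℕ; zero; suc; _+_; _∸_; _≤_; _<_; _≡ᵇ_)
open import Data.Bool using (if_then_else_)
open import Data.Product using (_×_; _,_; Σ)
open import Data.Sum using (_⊎_)
open import Data.List using (List; []; _∷_; map)
open import Data.List.Relation.Unary.All using (All)
open import Data.List.Relation.Unary.Linked using (Linked)
open import Data.List.Membership.Propositional using (_∈_)
open import Relation.Binary.PropositionalEquality using (_≡_)
open import Relation.Nullary using (¬_)

Arc : Set
Arc = ℕ × ℕ

_<ₐ_ : Arc → Arc → Set
(i , j) <ₐ (k , l) = i < k ⊎ (i ≡ k × j < l)

ArcOn : ℕ → Arc → Set
ArcOn n (i , j) = 1 ≤ i × i < j × j ≤ n

-- A diagram (simple graph) on [n] is represented canonically by the
-- strictly lexicographically sorted list of its arcs (so its arc set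
-- determines the list uniquely, and no arc is repeated).
IsDiagram : ℕ → List Arc → Set
IsDiagram n D = All (ArcOn n) D × Linked _<ₐ_ D

ld : List Arc → ℕ → ℕ
ld [] v = 0
ld ((i , j) ∷ D) v = if j ≡ᵇ v then suc (ld D v) else ld D v

rd : List Arc → ℕ → ℕ
rd [] v = 0
rd ((i , j) ∷ D) v = if i ≡ᵇ v then suc (rd D v) else rd D v

deg : List Arc → ℕ → ℕ
deg D v = ld D v + rd D v

length : Arc → ℕ
length (i , j) = j ∸ i

Crossing : Arc → Arc → Set
Crossing (i₁ , j₁) (i₂ , j₂) = i₁ < i₂ × i₂ < j₁ × j₁ < j₂

IsStack : ℕ → List Arc → Set
IsStack n D = IsDiagram n D × (∀ a b → a ∈ D → b ∈ D → ¬ Crossing a b)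

IsRegular : ℕ → List Arc → Set
IsRegular m D = All (λ a → m ≤ length a) D

IsLinear : ℕ → List Arc → Set
IsLinear n D = ∀ v → 1 ≤ v → v ≤ n → deg D v ≤ 2

IsRegLinStack : ℕ → ℕ → List Arc → Set
IsRegLinStack m n D = IsStack n D × IsRegular m D × IsLinear n D

IsZigzagStack : ℕ → List Arc → Set
IsZigzagStack n D =
  IsStack n D × IsLinear n D ×
  (∀ v → 1 ≤ v → v ≤ n → ¬ (0 < ld D v × 0 < rd D v))

IsReducedZigzag : ℕ → ℕ → List Arc → Set
IsReducedZigzag m n D =
  IsZigzagStack n D ×
  (∀ i → 1 ≤ i → i + (m ∸ 1) ≤ n → ld D i + rd D (i + (m ∸ 1)) ≤ 2) ×
  (∀ i j → 1 ≤ i → i < j → j ≤ n → 0 < ld D i → 0 < rd D j → m ∸ 1 ≤ j ∸ i)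

θ : ℕ → List Arc → List Arc
θ m = map (λ { (i , j) → (i , j ∸ (m ∸ 1)) })

-- Write k = m - 1. As θ moves only right endpoints, ld (θ S) v = ld S (v + k) and
-- rd (θ S) v = rd S v. Hence condition (1) of m-reducedness is linearity of S at i + k,
-- while the zigzag condition and condition (2) say that S has no arcs (a , i + k) and
-- (j , b) with i ≤ j < i + k; such arcs would cross, as m-regularity gives a < i and
-- j + k < b. Conversely, ψ moves the right endpoints of an m-reduced zigzag stack k steps
-- to the right and is inverse to θ: a crossing of the image would come from a crossing,
-- a vertex violating the zigzag condition, or a pair violating condition (2).
module Submission where

open import Defs
open import Data.Bool using (true; false; if_then_else_)
open import Data.Empty using (⊥)
open import Data.Nat using (ℕ; zero; suc; _+_; _∸_; _≤_; _<_; _≡ᵇ_; z≤n; s≤s; z<s; _≤?_; _<?_; _≟_)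
open import Data.Nat.Properties
open import Data.Product using (_×_; _,_; Σ; ∃; proj₁; proj₂; map₂)
open import Data.Sum using (inj₁; inj₂)
open import Data.List using (List; []; _∷_; map)
open import Data.List.Properties using (map-∘; map-cong; map-id)
open import Data.List.Relation.Unary.All as All using (All; []; _∷_)
import Data.List.Relation.Unary.All.Properties as All
open import Data.List.Relation.Unary.Any using (here; there)
open import Data.List.Relation.Unary.Linked as Linked using (Linked; []; [-]; _∷_)
import Data.List.Relation.Unary.Linked.Properties as Linked
open import Data.List.Membership.Propositional using (_∈_)
open import Data.List.Membership.Propositional.Properties using (∈-map⁻)
open import Function.Bundles using (_⇔_; mk⇔)
open import Function.Base using (_∘_; id)
open import Relation.Binary.Definitions using (tri<; tri≈; tri>)
open import Relation.Binary.PropositionalEquality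
  using (_≡_; _≢_; refl; sym; trans; cong; cong₂; subst; subst₂; module ≡-Reasoning)
open import Relation.Nullary using (¬_; yes; no; contradiction)
open import Relation.Nullary.Decidable using (does-⇔; dec-true; dec-false; _×-dec_)

private
  variable
    k n N i j i′ j′ v w : ℕ
    D S T : List Arc

NonCrossing : List Arc → Set
NonCrossing D = ∀ a b → a ∈ D → b ∈ D → ¬ Crossing a b

ψ : ℕ → List Arc → List Arc
ψ k = map (map₂ (_+ k))

+-≤-if-¬both-positive : ∀ {x y c} → x ≤ c → y ≤ c → ¬ (0 < x × 0 < y) → x + y ≤ c
+-≤-if-¬both-positive {zero}                  _   y≤c _    = y≤c
+-≤-if-¬both-positive {suc x} {zero}  {c}     x≤c _   _    = subst (_≤ c) (sym (+-identityʳ (suc x))) x≤c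
+-≤-if-¬both-positive {suc x} {suc y}         _   _   both = contradiction (z<s , z<s) both

m∸o<n∸o⇒m<n : ∀ {m n} o → m ∸ o < n ∸ o → m < n
m∸o<n∸o⇒m<n {m} {n} o m∸o<n∸o = ≰⇒> (λ (n≤m : n ≤ m) → <⇒≱ m∸o<n∸o (∸-monoˡ-≤ o n≤m))

0<m∸n⇒n<m : ∀ {m n} → 0 < m ∸ n → n < m
0<m∸n⇒n<m 0<m∸n = m∸n≢0⇒n<m (>⇒≢ 0<m∸n)

regular⇒+< : ∀ a → suc k ≤ length a → proj₁ a + k < proj₂ a
regular⇒+< {k} (i , j) regular =
  subst (_≤ j) (cong suc (+-comm k i))
    (m≤o∸n⇒m+n≤o (suc k) (<⇒≤ (0<m∸n⇒n<m (<-≤-trans z<s regular))) regular)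

regular⇒≤ : ∀ a → suc k ≤ length a → k ≤ proj₂ a
regular⇒≤ {k} (i , j) regular = ≤-trans (m≤n+m k i) (<⇒≤ (regular⇒+< (i , j) regular))

ld-∷-≤ : ∀ a D v → ld D v ≤ ld (a ∷ D) v
ld-∷-≤ (i , j) D v with j ≡ᵇ v
... | true  = n≤1+n _
... | false = ≤-refl

rd-∷-≤ : ∀ a D v → rd D v ≤ rd (a ∷ D) v
rd-∷-≤ (i , j) D v with i ≡ᵇ v
... | true  = n≤1+n _
... | false = ≤-refl

-- In ld and rd, j ≡ᵇ v is definitionally does (j ≟ v), so lemmas about Dec apply.
ld-∷-≢ : ∀ D v → j ≢ v → ld ((i , j) ∷ D) v ≡ ld D v
ld-∷-≢ {j} D v j≢v rewrite dec-false (j ≟ v) j≢v = refl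

rd-∷-≢ : ∀ D v → i ≢ v → rd ((i , j) ∷ D) v ≡ rd D v
rd-∷-≢ {i} D v i≢v rewrite dec-false (i ≟ v) i≢v = refl

∈⇒0<ld : (i , v) ∈ D → 0 < ld D v
∈⇒0<ld {v = v} (here refl) rewrite dec-true (v ≟ v) refl = z<s
∈⇒0<ld {v = v} {D = a ∷ D} (there p) = <-≤-trans (∈⇒0<ld p) (ld-∷-≤ a D v)

∈⇒0<rd : (v , j) ∈ D → 0 < rd D v
∈⇒0<rd {v = v} (here refl) rewrite dec-true (v ≟ v) refl = z<s
∈⇒0<rd {v = v} {D = a ∷ D} (there p) = <-≤-trans (∈⇒0<rd p) (rd-∷-≤ a D v)

0<ld⇒∈ : ∀ D v → 0 < ld D v → ∃ λ i → (i , v) ∈ D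
0<ld⇒∈ ((i , j) ∷ D) v h with j ≟ v
... | yes refl = i , here refl
... | no j≢v   = map₂ there (0<ld⇒∈ D v (subst (0 <_) (ld-∷-≢ {i = i} D v j≢v) h))

0<rd⇒∈ : ∀ D v → 0 < rd D v → ∃ λ j → (v , j) ∈ D
0<rd⇒∈ ((i , j) ∷ D) v h with i ≟ v
... | yes refl = j , here refl
... | no i≢v   = map₂ there (0<rd⇒∈ D v (subst (0 <_) (rd-∷-≢ {j = j} D v i≢v) h))

0<ld⇒inRange : All (ArcOn N) D → 0 < ld D v → 1 ≤ v × v ≤ N
0<ld⇒inRange {D = D} {v} arcs h =
  let (1≤i , i<v , v≤N) = All.lookup arcs (proj₂ (0<ld⇒∈ D v h)) in ≤-trans 1≤i (<⇒≤ i<v) , v≤N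

0<rd⇒inRange : All (ArcOn N) D → 0 < rd D v → 1 ≤ v × v ≤ N
0<rd⇒inRange {D = D} {v} arcs h =
  let (1≤v , v<j , j≤N) = All.lookup arcs (proj₂ (0<rd⇒∈ D v h)) in 1≤v , ≤-trans (<⇒≤ v<j) j≤N

ld-vanishes : All (ArcOn N) D → ¬ (1 ≤ v × v ≤ N) → ld D v ≡ 0
ld-vanishes arcs out = n≤0⇒n≡0 (≮⇒≥ (out ∘ 0<ld⇒inRange arcs))

rd-vanishes : All (ArcOn N) D → ¬ (1 ≤ v × v ≤ N) → rd D v ≡ 0
rd-vanishes arcs out = n≤0⇒n≡0 (≮⇒≥ (out ∘ 0<rd⇒inRange arcs))

deg≤2 : IsDiagram N D → IsLinear N D → ∀ v → deg D v ≤ 2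
deg≤2 {N} (arcs , _) lin v with 1 ≤? v ×-dec v ≤? N
... | yes (1≤v , v≤N) = lin v 1≤v v≤N
... | no out = subst (_≤ 2) (sym (cong₂ _+_ (ld-vanishes arcs out) (rd-vanishes arcs out))) z≤n

ld≤2 : IsDiagram N D → IsLinear N D → ∀ v → ld D v ≤ 2
ld≤2 {D = D} dg lin v = ≤-trans (m≤m+n (ld D v) (rd D v)) (deg≤2 dg lin v)

rd≤2 : IsDiagram N D → IsLinear N D → ∀ v → rd D v ≤ 2
rd≤2 {D = D} dg lin v = ≤-trans (m≤n+m (rd D v) (ld D v)) (deg≤2 dg lin v)

ld-map₂ : ∀ g D → All (λ a → g (proj₂ a) ≡ v ⇔ proj₂ a ≡ w) D → ld (map (map₂ g) D) v ≡ ld D w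
ld-map₂ g [] [] = refl
ld-map₂ {v} {w} g ((i , j) ∷ D) (j↦ ∷ D↦) =
  cong₂ (λ b n → if b then suc n else n) (does-⇔ j↦ (g j ≟ v) (j ≟ w)) (ld-map₂ g D D↦)

rd-map₂ : ∀ g D v → rd (map (map₂ g) D) v ≡ rd D v
rd-map₂ g [] v = refl
rd-map₂ g ((i , j) ∷ D) v = cong (λ n → if i ≡ᵇ v then suc n else n) (rd-map₂ g D v)

<ₐ-map₂ : ∀ {g : ℕ → ℕ} → (j < j′ → g j < g j′) → (i , j) <ₐ (i′ , j′) → (i , g j) <ₐ (i′ , g j′)
<ₐ-map₂ mono (inj₁ i<i′)         = inj₁ i<i′
<ₐ-map₂ mono (inj₂ (refl , j<j′)) = inj₂ (refl , mono j<j′)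

θ-arcOn : ∀ a → ArcOn (n + k) a → suc k ≤ length a → ArcOn n (map₂ (_∸ k) a)
θ-arcOn {n} {k} (i , j) (1≤i , _ , j≤n+k) regular =
  1≤i , m+n≤o⇒m≤o∸n (suc i) (regular⇒+< (i , j) regular)
      , m≤n+o⇒m∸n≤o j k (subst (j ≤_) (+-comm n k) j≤n+k)

θ-arcs : All (ArcOn (n + k)) S → IsRegular (suc k) S → All (ArcOn n) (θ (suc k) S)
θ-arcs arcs reg = All.map⁺ (All.zipWith (λ {a} (arc , regular) → θ-arcOn a arc regular) (arcs , reg))

θ-sorted : IsRegular (suc k) S → Linked _<ₐ_ S → Linked _<ₐ_ (θ (suc k) S)
θ-sorted reg [] = []
θ-sorted reg [-] = [-]
θ-sorted {k} {a ∷ _} (regular ∷ reg) (a<b ∷ sorted) =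
  <ₐ-map₂ (λ j<j′ → ∸-monoˡ-< j<j′ (regular⇒≤ a regular)) a<b ∷ θ-sorted reg sorted

θ-nonCrossing : NonCrossing S → NonCrossing (θ (suc k) S)
θ-nonCrossing {S} {k} nc _ _ a∈ b∈ cross with ∈-map⁻ (map₂ (_∸ k)) a∈ | ∈-map⁻ (map₂ (_∸ k)) b∈
... | (i₁ , j₁) , p₁ , refl | (i₂ , j₂) , p₂ , refl =
  let (i₁<i₂ , i₂<j₁∸k , j₁∸k<j₂∸k) = cross
  in nc _ _ p₁ p₂ (i₁<i₂ , <-≤-trans i₂<j₁∸k (m∸n≤m j₁ k) , m∸o<n∸o⇒m<n k j₁∸k<j₂∸k)

ld-θ : IsRegular (suc k) S → ∀ v → ld (θ (suc k) S) v ≡ ld S (v + k)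
ld-θ {k} {S} reg v = ld-map₂ (_∸ k) S (All.map (λ {a} → endpoint-shift a) reg)
  where
  endpoint-shift : ∀ a → suc k ≤ length a → proj₂ a ∸ k ≡ v ⇔ proj₂ a ≡ v + k
  endpoint-shift a regular = mk⇔
    (λ e → trans (sym (m∸n+n≡m (regular⇒≤ a regular))) (cong (_+ k) e))
    (λ e → trans (cong (_∸ k) e) (m+n∸n≡m v k))

ld-rd-apart : IsRegular (suc k) S → NonCrossing S →
              0 < ld S (i + k) → 0 < rd S j → i ≤ j → j < i + k → ⊥
ld-rd-apart {k} {S} {i} {j} reg nc into out i≤j j<i+k =
  let (a , a↦i+k) = 0<ld⇒∈ S (i + k) into
      (b , j↦b)   = 0<rd⇒∈ S j out
      a+k<i+k     = regular⇒+< (a , i + k) (All.lookup reg a↦i+k)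
      j+k<b       = regular⇒+< (j , b) (All.lookup reg j↦b)
  in nc _ _ a↦i+k j↦b
       (<-≤-trans (+-cancelʳ-< k _ _ a+k<i+k) i≤j , j<i+k , ≤-<-trans (+-monoˡ-≤ k i≤j) j+k<b)

θ-reducedZigzag : 1 ≤ k → IsRegLinStack (suc k) (n + k) S →
                  IsDiagram n (θ (suc k) S) × IsReducedZigzag (suc k) n (θ (suc k) S)
θ-reducedZigzag {k} {n} {S} 1≤k ((dg@(arcs , sorted) , nc) , reg , lin) =
  diagram , (((diagram , θ-nonCrossing {k = k} nc) , linear , notBoth) , reduced₁ , reduced₂)
  where
  diagram : IsDiagram n (θ (suc k) S)
  diagram = θ-arcs arcs reg , θ-sorted reg sorted

  rd-θ : ∀ v → rd (θ (suc k) S) v ≡ rd S v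
  rd-θ = rd-map₂ (_∸ k) S

  apart : ∀ {i j} → 0 < ld (θ (suc k) S) i → 0 < rd (θ (suc k) S) j → i ≤ j → j < i + k → ⊥
  apart {i} {j} into out =
    ld-rd-apart reg nc (subst (0 <_) (ld-θ reg i) into) (subst (0 <_) (rd-θ j) out)

  notBoth : ∀ v → 1 ≤ v → v ≤ n → ¬ (0 < ld (θ (suc k) S) v × 0 < rd (θ (suc k) S) v)
  notBoth v _ _ (into , out) = apart into out ≤-refl (m<m+n v 1≤k)

  linear : IsLinear n (θ (suc k) S)
  linear v 1≤v v≤n = +-≤-if-¬both-positive
    (subst (_≤ 2) (sym (ld-θ reg v)) (ld≤2 dg lin (v + k)))
    (subst (_≤ 2) (sym (rd-θ v)) (rd≤2 dg lin v))
    (notBoth v 1≤v v≤n)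

  reduced₁ : ∀ i → 1 ≤ i → i + k ≤ n → ld (θ (suc k) S) i + rd (θ (suc k) S) (i + k) ≤ 2
  reduced₁ i 1≤i i+k≤n = subst₂ (λ x y → x + y ≤ 2) (sym (ld-θ reg i)) (sym (rd-θ (i + k)))
    (lin (i + k) (≤-trans 1≤i (m≤m+n i k)) (≤-trans i+k≤n (m≤m+n n k)))

  reduced₂ : ∀ i j → 1 ≤ i → i < j → j ≤ n →
             0 < ld (θ (suc k) S) i → 0 < rd (θ (suc k) S) j → k ≤ j ∸ i
  reduced₂ i j _ i<j _ into out = ≮⇒≥ λ j∸i<k →
    apart into out (<⇒≤ i<j) (subst (_< i + k) (m+[n∸m]≡n (<⇒≤ i<j)) (+-monoʳ-< i j∸i<k))

ψ∘θ : All (λ a → k ≤ proj₂ a) S → ψ k (θ (suc k) S) ≡ S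
ψ∘θ [] = refl
ψ∘θ {S = (i , j) ∷ S} (k≤j ∷ k≤ends) = cong₂ _∷_ (cong (i ,_) (m∸n+n≡m k≤j)) (ψ∘θ k≤ends)

θ∘ψ : ∀ k D → θ (suc k) (ψ k D) ≡ D
θ∘ψ k D = begin
  map (map₂ (_∸ k)) (map (map₂ (_+ k)) D) ≡⟨ map-∘ D ⟨
  map (map₂ ((_∸ k) ∘ (_+ k))) D          ≡⟨ map-cong (λ (i , j) → cong (i ,_) (m+n∸n≡m j k)) D ⟩
  map id D                                ≡⟨ map-id D ⟩
  D                                       ∎
  where open ≡-Reasoning

θ-injective : IsRegular (suc k) S → IsRegular (suc k) T → θ (suc k) S ≡ θ (suc k) T → S ≡ T
θ-injective {k} {S} {T} regS regT θS≡θT = begin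
  S                   ≡⟨ ψ∘θ (All.map (λ {a} → regular⇒≤ a) regS) ⟨
  ψ k (θ (suc k) S)   ≡⟨ cong (ψ k) θS≡θT ⟩
  ψ k (θ (suc k) T)   ≡⟨ ψ∘θ (All.map (λ {a} → regular⇒≤ a) regT) ⟩
  T                   ∎
  where open ≡-Reasoning

ψ-arcOn : ∀ a → ArcOn n a → ArcOn (n + k) (map₂ (_+ k) a)
ψ-arcOn {n} {k} (i , j) (1≤i , i<j , j≤n) = 1≤i , <-≤-trans i<j (m≤m+n j k) , +-monoˡ-≤ k j≤n

ψ-regular : ∀ a → ArcOn n a → suc k ≤ length (map₂ (_+ k) a)
ψ-regular {k = k} (i , j) (_ , i<j , _) =
  m+n≤o⇒m≤o∸n (suc k) (subst (suc (k + i) ≤_) (+-comm k j) (+-monoʳ-< k i<j))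

ld-ψ : All (ArcOn n) D → ∀ v → ld (ψ k D) v ≡ ld D (v ∸ k)
ld-ψ {n} {D} {k} arcs v = ld-map₂ (_+ k) D (All.map (λ {a} → endpoint-shift a) arcs)
  where
  endpoint-shift : ∀ a → ArcOn n a → proj₂ a + k ≡ v ⇔ proj₂ a ≡ v ∸ k
  endpoint-shift (i , j) (1≤i , i<j , _) = mk⇔
    (λ e → trans (sym (m+n∸n≡m j k)) (cong (_∸ k) e))
    (λ e → trans (cong (_+ k) e) (m∸n+n≡m {n = k} (<⇒≤ (0<m∸n⇒n<m (subst (0 <_) e 0<j)))))
    where 0<j = ≤-trans 1≤i (<⇒≤ i<j)

ψ-nonCrossing : All (ArcOn n) D → NonCrossing D →
                (∀ v → 1 ≤ v → v ≤ n → ¬ (0 < ld D v × 0 < rd D v)) →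
                (∀ i j → 1 ≤ i → i < j → j ≤ n → 0 < ld D i → 0 < rd D j → k ≤ j ∸ i) →
                NonCrossing (ψ k D)
ψ-nonCrossing {n} {D} {k} arcs nc zigzag reduced₂ _ _ a∈ b∈ cross
  with ∈-map⁻ (map₂ (_+ k)) a∈ | ∈-map⁻ (map₂ (_+ k)) b∈
... | (i₁ , j₁) , p₁ , refl | (i₂ , j₂) , p₂ , refl
  with (i₁<i₂ , i₂<j₁+k , j₁+k<j₂+k) ← cross
     | (1≤i₁ , i₁<j₁ , j₁≤n) ← All.lookup arcs p₁
     | (_ , i₂<j₂ , j₂≤n) ← All.lookup arcs p₂
     | <-cmp i₂ j₁
... | tri< i₂<j₁ _ _ = nc _ _ p₁ p₂ (i₁<i₂ , i₂<j₁ , +-cancelʳ-< k j₁ j₂ j₁+k<j₂+k)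
... | tri≈ _ refl _  = zigzag i₂ (≤-trans 1≤i₁ (<⇒≤ i₁<j₁)) j₁≤n (∈⇒0<ld p₁ , ∈⇒0<rd p₂)
... | tri> _ _ j₁<i₂ = <⇒≱ i₂<j₁+k (subst (_≤ i₂) (+-comm k j₁) (m≤o∸n⇒m+n≤o k (<⇒≤ j₁<i₂)
        (reduced₂ j₁ i₂ (≤-trans 1≤i₁ (<⇒≤ i₁<j₁)) j₁<i₂ (≤-trans (<⇒≤ i₂<j₂) j₂≤n)
                  (∈⇒0<ld p₁) (∈⇒0<rd p₂))))

ψ-linear : IsDiagram n D → IsLinear n D →
           (∀ i → 1 ≤ i → i + k ≤ n → ld D i + rd D (i + k) ≤ 2) →
           IsLinear (n + k) (ψ k D)
ψ-linear {n} {D} {k} dg@(arcs , _) lin reduced₁ v _ _ =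
  subst₂ (λ x y → x + y ≤ 2) (sym (ld-ψ arcs v)) (sym (rd-map₂ (_+ k) D v)) bound
  where
  bound : ld D (v ∸ k) + rd D v ≤ 2
  bound with v ≤? n | k <? v
  ... | no v≰n | _ =
    subst (λ y → ld D (v ∸ k) + y ≤ 2) (sym (rd-vanishes arcs (v≰n ∘ proj₂)))
          (subst (_≤ 2) (sym (+-identityʳ _)) (ld≤2 dg lin (v ∸ k)))
  ... | yes _ | no k≮v =   -- here v ∸ k truncates to 0, where no arc ends
    subst (λ x → x + rd D v ≤ 2) (sym (ld-vanishes arcs (k≮v ∘ 0<m∸n⇒n<m ∘ proj₁)))
          (rd≤2 dg lin v)
  ... | yes v≤n | yes k<v =
    subst (λ x → ld D (v ∸ k) + rd D x ≤ 2) (m∸n+n≡m (<⇒≤ k<v))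
          (reduced₁ (v ∸ k) (m<n⇒0<n∸m k<v) (subst (_≤ n) (sym (m∸n+n≡m (<⇒≤ k<v))) v≤n))

ψ-regLinStack : IsReducedZigzag (suc k) n D → IsRegLinStack (suc k) (n + k) (ψ k D)
ψ-regLinStack {k} ((((arcs , sorted) , nc) , lin , zigzag) , reduced₁ , reduced₂) =
  ( ( All.map⁺ (All.map (λ {a} → ψ-arcOn a) arcs)
    , Linked.map⁺ (Linked.map (<ₐ-map₂ (+-monoˡ-< k)) sorted))
  , ψ-nonCrossing arcs nc zigzag reduced₂)
  , All.map⁺ (All.map (λ {a} → ψ-regular a) arcs)
  , ψ-linear (arcs , sorted) lin reduced₁

mainTheorem6 : (m n : ℕ) → 2 ≤ m →
    ((S : List Arc) → IsRegLinStack m (n + (m ∸ 1)) S →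
       IsDiagram n (θ m S) × IsReducedZigzag m n (θ m S)) ×
    ((S T : List Arc) → IsRegLinStack m (n + (m ∸ 1)) S →
       IsRegLinStack m (n + (m ∸ 1)) T → θ m S ≡ θ m T → S ≡ T) ×
    ((D : List Arc) → IsReducedZigzag m n D →
       Σ (List Arc) (λ S → IsRegLinStack m (n + (m ∸ 1)) S × θ m S ≡ D))
mainTheorem6 (suc k) n (s≤s 1≤k) =
  (λ S → θ-reducedZigzag 1≤k)
  , (λ S T (_ , regS , _) (_ , regT , _) → θ-injective regS regT)
  , λ D reduced → ψ k D , ψ-regLinStack reduced , θ∘ψ k D
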